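{- There exists a set $L \subseteq \Sigma^\ast$ (with $\Sigma=\{0,1\}$) such that no set in the 1-truth-table degree of $L$ is retraceable; indeed, no set in the 1-truth-table upward cone $\{L' \subseteq \Sigma^\ast \mid L \leq_{1\text{ - }tt} L'\}$ of $L$ is retraceable.
   Context: All sets are subsets of $\Sigma^\ast$ with $\Sigma=\{0,1\}$. The lexicographic order on $\Sigma^\ast$ is the length-then-lexicographic order $\epsilon < 0 < 1 < 00 < 01 < \cdots$. $A \leq_{1\text{ - }tt} B$ (recursive 1-truth-table reducibility) means $A$ is Turing reducible to $B$ via a recursive oracle machine that halts on every input and makes at most one query to its oracle; the 1-truth-table degree of $L$ is $\{L' \mid L \leq_{1\text{ - }tt} L' \text{ and } L' \leq_{1\text{ - }tt} L\}$. A set $A$ is retraceable if there exist an enumeration $a_0, a_1, a_2, \ldots$ of $A$ without repetitions that lists the elements of $A$ in increasing lexicographic order (the enumeration need not be recursive), and a partial recursive function $f$ such that $f(a_0)=a_0$ and $f(a_{n+1}) = a_n$ for all $n$. -}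

module Defs where

open import Data.Nat using (ℕ; zero; suc; _+_; _*_; _∸_; _<_)
open import Data.Bool using (Bool; true; false)
open import Data.List using (List; []; _∷_; length)
open import Data.Vec using (Vec; []; _∷_)
open import Data.Fin using (Fin)
open import Data.Vec using (lookup)
open import Data.Product using (Σ; ∃; _×_; _,_)
open import Data.Sum using (_⊎_)
open import Data.Empty using (⊥)
open import Data.Unit using (⊤)
open import Relation.Nullary using (¬_)
open import Relation.Binary.PropositionalEquality using (_≡_)
open import Function.Bundles using (_⇔_)

-- Strings over Σ = {0,1}: false = 0, true = 1.

Word : Set
Word = List Bool

Lang : Set₁
Lang = Word → Set

data LexLT : Word → Word → Set where
  here  : ∀ {u v} → LexLT (false ∷ u) (true ∷ v)
  there : ∀ {b u v} → LexLT u v → LexLT (b ∷ u) (b ∷ v)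

_<ₗₗ_ : Word → Word → Set
u <ₗₗ v = (length u < length v) ⊎ ((length u ≡ length v) × LexLT u v)

-- Standard bijection Σ* ≅ ℕ : w ↦ (value of binary numeral 1w) − 1.
-- (ε ↦ 0, 0 ↦ 1, 1 ↦ 2, 00 ↦ 3, ...; it is order-preserving for <ₗₗ.)

bit : Bool → ℕ
bit false = 0
bit true  = 1

binAcc : ℕ → Word → ℕ
binAcc acc []      = acc
binAcc acc (b ∷ w) = binAcc (2 * acc + bit b) w

enc : Word → ℕ
enc w = binAcc 1 w ∸ 1

data Code : ℕ → Set where
  zer  : ∀ {n} → Code n
  succ : Code 1
  proj : ∀ {n} → Fin n → Code n
  comp : ∀ {n m} → Code m → Vec (Code n) m → Code n
  prec : ∀ {n} → Code n → Code (suc (suc n)) → Code (suc n)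
  mu   : ∀ {n} → Code (suc n) → Code n

mutual
  data Eval : ∀ {n} → Code n → Vec ℕ n → ℕ → Set where
    e-zer  : ∀ {n} {xs : Vec ℕ n} → Eval zer xs 0
    e-succ : ∀ {x} → Eval succ (x ∷ []) (suc x)
    e-proj : ∀ {n} {i : Fin n} {xs : Vec ℕ n} → Eval (proj i) xs (lookup xs i)
    e-comp : ∀ {n m} {f : Code m} {gs : Vec (Code n) m} {xs : Vec ℕ n}
               {ys : Vec ℕ m} {z : ℕ} →
             EvalAll gs xs ys → Eval f ys z → Eval (comp f gs) xs z
    e-prec0 : ∀ {n} {f : Code n} {g : Code (suc (suc n))} {xs : Vec ℕ n} {z} →
              Eval f xs z → Eval (prec f g) (0 ∷ xs) z
    e-precS : ∀ {n} {f : Code n} {g : Code (suc (suc n))} {xs : Vec ℕ n} {x r z} →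
              Eval (prec f g) (x ∷ xs) r → Eval g (x ∷ r ∷ xs) z →
              Eval (prec f g) (suc x ∷ xs) z
    e-mu : ∀ {n} {f : Code (suc n)} {xs : Vec ℕ n} {k} →
           Eval f (k ∷ xs) 0 →
           (∀ j → j < k → ∃ λ m → Eval f (j ∷ xs) (suc m)) →
           Eval (mu f) xs k

  data EvalAll : ∀ {n m} → Vec (Code n) m → Vec ℕ n → Vec ℕ m → Set where
    ea-[] : ∀ {n} {xs : Vec ℕ n} → EvalAll [] xs []
    ea-∷  : ∀ {n m} {g : Code n} {gs : Vec (Code n) m} {xs : Vec ℕ n} {y ys} →
            Eval g xs y → EvalAll gs xs ys → EvalAll (g ∷ gs) xs (y ∷ ys)

-- A recursive oracle machine that halts on every input and makes at most
-- one query is described by two total recursive functions of the input x: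
-- the query string q(x) and the truth table t(x) telling how the output
-- depends on the oracle answer b:
--   0: output 0 (no query needed), 1: output 1, 2: output b, ≥3: output ¬b.

table : ℕ → Set → Set
table 0 P             = ⊥
table 1 P             = ⊤
table 2 P             = P
table (suc (suc (suc _))) P = ¬ P

_≤1tt_ : Lang → Lang → Set
A ≤1tt B = Σ (Code 1) λ q → Σ (Code 1) λ t →
  ∀ (x : Word) → Σ Word λ y → Σ ℕ λ k →
    Eval q (enc x ∷ []) (enc y) × Eval t (enc x ∷ []) k × (A x ⇔ table k (B y))

In1ttDegree : Lang → Lang → Set
In1ttDegree L L' = (L ≤1tt L') × (L' ≤1tt L)

Retraceable : Lang → Set
Retraceable A = Σ (ℕ → Word) λ a →
  (∀ n → a n <ₗₗ a (suc n))
  × (∀ w → A w ⇔ (∃ λ n → a n ≡ w))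
  × Σ (Code 1) λ f →
      Eval f (enc (a 0) ∷ []) (enc (a 0))
      × (∀ n → Eval f (enc (a (suc n)) ∷ []) (enc (a n)))

-- For every candidate 1-tt reduction (q, t) and every candidate retracing function f, L contains
-- two witness strings x₀, x₁ with queries y₀ = q(x₀), y₁ = q(x₁).  Call lo the lower of the two
-- queries and hi the other one.  At the witness querying hi, L is chosen so that a correct
-- reduction forces hi into the target set A; at the witness querying lo, L is chosen to disagree
-- with "lo lies on the f-orbit of hi".  But if A is retraced by f and hi ∈ A, then a string below
-- hi lies in A exactly when it lies on the f-orbit of hi, so (q, t) cannot reduce L to A.
module Submission where

open import Defs
open import Data.Bool using (Bool; true; false; not)
open import Data.Empty using (⊥; ⊥-elim)
open import Data.Fin using (toℕ)
open import Data.Fin.Properties using (toℕ-injective)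
open import Data.List using ([]; _∷_; length)
open import Data.List.Properties using (∷-injectiveʳ)
open import Data.Nat
open import Data.Nat.Properties
open import Data.Nat.Tactic.RingSolver using (solve-∀)
open import Data.Product using (Σ; ∃; _×_; _,_; proj₁; proj₂)
open import Data.Sum using (_⊎_; inj₁; inj₂)
import Data.Sum as Sum
open import Data.Unit using (⊤)
open import Data.Vec using (Vec; []; _∷_)
open import Function using (_∘_; id)
open import Function.Bundles using (_⇔_; mk⇔; Equivalence)
open import Function.Properties.Equivalence using () renaming (sym to ⇔-sym; trans to ⇔-trans)
open import Relation.Binary using (tri<; tri≈; tri>)
open import Relation.Binary.Construct.Closure.ReflexiveTransitive using (Star; ε; _◅_)
open import Relation.Binary.PropositionalEquality
open import Relation.Nullary using (¬_)

open Equivalence using (to; from)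

mutual
  Eval-deterministic : ∀ {n} {c : Code n} {xs y y′} → Eval c xs y → Eval c xs y′ → y ≡ y′
  Eval-deterministic e-zer e-zer = refl
  Eval-deterministic e-succ e-succ = refl
  Eval-deterministic e-proj e-proj = refl
  Eval-deterministic (e-comp as e) (e-comp as′ e′) with EvalAll-deterministic as as′
  ... | refl = Eval-deterministic e e′
  Eval-deterministic (e-prec0 e) (e-prec0 e′) = Eval-deterministic e e′
  Eval-deterministic (e-precS e g) (e-precS e′ g′) with Eval-deterministic e e′
  ... | refl = Eval-deterministic g g′
  Eval-deterministic (e-mu {k = k} z below) (e-mu {k = k′} z′ below′) with <-cmp k k′
  ... | tri≈ _ k≡k′ _ = k≡k′
  ... | tri< k<k′ _ _ with below′ k k<k′
  ...   | _ , s = ⊥-elim (0≢1+n (Eval-deterministic z s))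
  Eval-deterministic (e-mu z below) (e-mu z′ below′) | tri> _ _ k′<k with below _ k′<k
  ...   | _ , s = ⊥-elim (0≢1+n (Eval-deterministic z′ s))

  EvalAll-deterministic : ∀ {n m} {gs : Vec (Code n) m} {xs ys ys′} →
                          EvalAll gs xs ys → EvalAll gs xs ys′ → ys ≡ ys′
  EvalAll-deterministic ea-[] ea-[] = refl
  EvalAll-deterministic (ea-∷ e as) (ea-∷ e′ as′) =
    cong₂ _∷_ (Eval-deterministic e e′) (EvalAll-deterministic as as′)

binAcc-split : ∀ a w → binAcc a w ≡ a * 2 ^ length w + binAcc 0 w
binAcc-split a [] = sym (trans (+-identityʳ _) (*-identityʳ a))
binAcc-split a (b ∷ w) = begin
  binAcc (2 * a + bit b) w                 ≡⟨ binAcc-split (2 * a + bit b) w ⟩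
  (2 * a + bit b) * p + binAcc 0 w         ≡⟨ regroup a (bit b) p (binAcc 0 w) ⟩
  a * (2 * p) + (bit b * p + binAcc 0 w)   ≡⟨ cong (a * (2 * p) +_) (binAcc-split (bit b) w) ⟨
  a * (2 * p) + binAcc (bit b) w           ∎
  where
  open ≡-Reasoning
  p = 2 ^ length w
  regroup : ∀ a c p r → (2 * a + c) * p + r ≡ a * (2 * p) + (c * p + r)
  regroup = solve-∀

bit≤1 : ∀ b → bit b ≤ 1
bit≤1 false = z≤n
bit≤1 true  = s≤s z≤n

binAcc0<2^length : ∀ w → binAcc 0 w < 2 ^ length w
binAcc0<2^length [] = s≤s z≤n
binAcc0<2^length (b ∷ w) = begin-strict
  binAcc (bit b) w        ≡⟨ binAcc-split (bit b) w ⟩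
  bit b * p + binAcc 0 w  <⟨ +-monoʳ-< (bit b * p) (binAcc0<2^length w) ⟩
  bit b * p + p           ≤⟨ +-monoˡ-≤ p (*-monoˡ-≤ p (bit≤1 b)) ⟩
  1 * p + p               ≡⟨ cong (_+ p) (*-identityˡ p) ⟩
  p + p                   ≡⟨ cong (p +_) (+-identityʳ p) ⟨
  2 * p                   ∎
  where
  open ≤-Reasoning
  p = 2 ^ length w

binAcc1-split : ∀ w → binAcc 1 w ≡ 2 ^ length w + binAcc 0 w
binAcc1-split w = trans (binAcc-split 1 w) (cong (_+ binAcc 0 w) (*-identityˡ _))

binAcc-monoʳ-LexLT : ∀ {u v} → LexLT u v → length u ≡ length v → ∀ a → binAcc a u < binAcc a v
binAcc-monoʳ-LexLT {false ∷ u} {true ∷ v} here |u|≡|v| a = begin-strict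
  binAcc (2 * a + 0) u          ≡⟨ binAcc-split (2 * a + 0) u ⟩
  (2 * a + 0) * q + binAcc 0 u  <⟨ +-monoʳ-< _ (binAcc0<2^length u) ⟩
  (2 * a + 0) * q + q           ≡⟨ cong (λ n → (2 * a + 0) * 2 ^ n + 2 ^ n) |u|≡|v|′ ⟩
  (2 * a + 0) * p + p           ≡⟨ shift (2 * a) p ⟩
  (2 * a + 1) * p               ≤⟨ m≤m+n _ _ ⟩
  (2 * a + 1) * p + binAcc 0 v  ≡⟨ binAcc-split (2 * a + 1) v ⟨
  binAcc (2 * a + 1) v          ∎
  where
  open ≤-Reasoning
  |u|≡|v|′ = suc-injective |u|≡|v|
  q = 2 ^ length u
  p = 2 ^ length v
  shift : ∀ x p → (x + 0) * p + p ≡ (x + 1) * p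
  shift = solve-∀
binAcc-monoʳ-LexLT (there {b} u<v) |u|≡|v| a =
  binAcc-monoʳ-LexLT u<v (suc-injective |u|≡|v|) (2 * a + bit b)

binAcc1-mono-<ₗₗ : ∀ {u v} → u <ₗₗ v → binAcc 1 u < binAcc 1 v
binAcc1-mono-<ₗₗ {u} {v} (inj₁ |u|<|v|) = begin-strict
  binAcc 1 u                    ≡⟨ binAcc1-split u ⟩
  2 ^ length u + binAcc 0 u     <⟨ +-monoʳ-< _ (binAcc0<2^length u) ⟩
  2 ^ length u + 2 ^ length u   ≡⟨ cong (2 ^ length u +_) (+-identityʳ _) ⟨
  2 ^ suc (length u)            ≤⟨ ^-monoʳ-≤ 2 |u|<|v| ⟩
  2 ^ length v                  ≤⟨ m≤m+n _ _ ⟩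
  2 ^ length v + binAcc 0 v     ≡⟨ binAcc1-split v ⟨
  binAcc 1 v                    ∎
  where open ≤-Reasoning
binAcc1-mono-<ₗₗ (inj₂ (|u|≡|v| , u<v)) = binAcc-monoʳ-LexLT u<v |u|≡|v| 1

binAcc1-positive : ∀ w → 1 ≤ binAcc 1 w
binAcc1-positive w rewrite binAcc1-split w = ≤-trans (m^n>0 2 (length w)) (m≤m+n _ _)

enc-mono-< : ∀ {u v} → u <ₗₗ v → enc u < enc v
enc-mono-< {u} u<v = ∸-monoˡ-< (binAcc1-mono-<ₗₗ u<v) (binAcc1-positive u)

Trichotomy : (Word → Word → Set) → Word → Word → Set
Trichotomy _<_ u v = u < v ⊎ u ≡ v ⊎ v < u

LexLT-trichotomy : ∀ u v → length u ≡ length v → Trichotomy LexLT u v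
LexLT-trichotomy [] [] _ = inj₂ (inj₁ refl)
LexLT-trichotomy (false ∷ u) (true ∷ v) _ = inj₁ here
LexLT-trichotomy (true ∷ u) (false ∷ v) _ = inj₂ (inj₂ here)
LexLT-trichotomy (false ∷ u) (false ∷ v) eq =
  Sum.map there (Sum.map (cong (false ∷_)) there) (LexLT-trichotomy u v (suc-injective eq))
LexLT-trichotomy (true ∷ u) (true ∷ v) eq =
  Sum.map there (Sum.map (cong (true ∷_)) there) (LexLT-trichotomy u v (suc-injective eq))

<ₗₗ-trichotomy : ∀ u v → Trichotomy _<ₗₗ_ u v
<ₗₗ-trichotomy u v with <-cmp (length u) (length v)
... | tri< |u|<|v| _ _ = inj₁ (inj₁ |u|<|v|)
... | tri> _ _ |v|<|u| = inj₂ (inj₂ (inj₁ |v|<|u|))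
... | tri≈ _ |u|≡|v| _ =
  Sum.map (inj₂ ∘ (|u|≡|v| ,_)) (Sum.map id (inj₂ ∘ (sym |u|≡|v| ,_)))
          (LexLT-trichotomy u v |u|≡|v|)

enc-injective : ∀ {u v} → enc u ≡ enc v → u ≡ v
enc-injective {u} {v} eq with <ₗₗ-trichotomy u v
... | inj₁ u<v        = ⊥-elim (<-irrefl eq (enc-mono-< u<v))
... | inj₂ (inj₁ u≡v) = u≡v
... | inj₂ (inj₂ v<u) = ⊥-elim (<-irrefl (sym eq) (enc-mono-< v<u))

unary : ℕ → Word → Word
unary zero    r = false ∷ r
unary (suc m) r = true ∷ unary m r

-- Serialisations are prefix-free, so they are written in front of a continuation r.
mutual
  serialise : ∀ {n} → Code n → Word → Word
  serialise zer                 r = false ∷ false ∷ false ∷ r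
  serialise succ                r = false ∷ false ∷ true ∷ r
  serialise (proj i)            r = false ∷ true ∷ false ∷ unary (toℕ i) r
  serialise (comp {m = m} f gs) r = false ∷ true ∷ true ∷ unary m (serialise f (serialiseAll gs r))
  serialise (prec f g)          r = true ∷ false ∷ false ∷ serialise f (serialise g r)
  serialise (mu f)              r = true ∷ false ∷ true ∷ serialise f r

  serialiseAll : ∀ {n m} → Vec (Code n) m → Word → Word
  serialiseAll []       r = r
  serialiseAll (g ∷ gs) r = serialise g (serialiseAll gs r)

drop-opcode : ∀ {a b c a′ b′ c′ : Bool} {u v : Word} →
              a ∷ b ∷ c ∷ u ≡ a′ ∷ b′ ∷ c′ ∷ v → u ≡ v
drop-opcode = ∷-injectiveʳ ∘ ∷-injectiveʳ ∘ ∷-injectiveʳ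

unary-injective : ∀ m m′ {r r′} → unary m r ≡ unary m′ r′ → m ≡ m′ × r ≡ r′
unary-injective zero    zero     refl = refl , refl
unary-injective (suc m) (suc m′) eq with unary-injective m m′ (∷-injectiveʳ eq)
... | refl , r≡r′ = refl , r≡r′

mutual
  serialise-injective : ∀ {n} (c c′ : Code n) {r r′} →
                        serialise c r ≡ serialise c′ r′ → c ≡ c′ × r ≡ r′
  serialise-injective zer zer refl = refl , refl
  serialise-injective succ succ refl = refl , refl
  serialise-injective (proj i) (proj i′) eq with unary-injective (toℕ i) (toℕ i′) (drop-opcode eq)
  ... | i≡i′ , r≡r′ rewrite toℕ-injective i≡i′ = refl , r≡r′
  serialise-injective (comp {m = m} f gs) (comp {m = m′} f′ gs′) eq
    with unary-injective m m′ (drop-opcode eq)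
  ... | refl , eq₁ with serialise-injective f f′ eq₁
  ... | refl , eq₂ with serialiseAll-injective gs gs′ eq₂
  ... | refl , r≡r′ = refl , r≡r′
  serialise-injective (prec f g) (prec f′ g′) eq with serialise-injective f f′ (drop-opcode eq)
  ... | refl , eq₁ with serialise-injective g g′ eq₁
  ... | refl , r≡r′ = refl , r≡r′
  serialise-injective (mu f) (mu f′) eq with serialise-injective f f′ (drop-opcode eq)
  ... | refl , r≡r′ = refl , r≡r′

  serialiseAll-injective : ∀ {n m} (gs gs′ : Vec (Code n) m) {r r′} →
                           serialiseAll gs r ≡ serialiseAll gs′ r′ → gs ≡ gs′ × r ≡ r′
  serialiseAll-injective [] [] eq = refl , eq
  serialiseAll-injective (g ∷ gs) (g′ ∷ gs′) eq with serialise-injective g g′ eq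
  ... | refl , eq₁ with serialiseAll-injective gs gs′ eq₁
  ... | refl , r≡r′ = refl , r≡r′

antitable : ℕ → Set → Set
antitable 0 P = ⊤
antitable 1 P = ⊥
antitable 2 P = ¬ P
antitable (suc (suc (suc _))) P = P

antitable-defeats : ∀ k {P Q : Set} → P ⇔ Q → ¬ (antitable k P ⇔ table k Q)
antitable-defeats 0 _ anti = to anti _
antitable-defeats 1 _ anti = from anti _
antitable-defeats 2 P⇔Q anti = ¬P (from P⇔Q (to anti ¬P))
  where
  ¬P : ¬ _
  ¬P p = from anti (to P⇔Q p) p
antitable-defeats (suc (suc (suc _))) P⇔Q anti = ¬Q (to P⇔Q (from anti ¬Q))
  where
  ¬Q : ¬ _
  ¬Q q = to anti (from P⇔Q q) q

antitable-forces : ∀ k {P Q : Set} → ¬ P → antitable k P ⇔ table k Q → ¬ ¬ Q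
antitable-forces k ¬P anti ¬Q = antitable-defeats k (mk⇔ (⊥-elim ∘ ¬P) (⊥-elim ∘ ¬Q)) anti

Step : Code 1 → ℕ → ℕ → Set
Step f u v = Eval f (u ∷ []) v

Orbit : Code 1 → Word → Word → Set
Orbit f u w = Star (Step f) (enc u) (enc w)

module Retracing (a : ℕ → Word) (a-increasing : ∀ n → a n <ₗₗ a (suc n))
                 (f : Code 1) (f-base : Step f (enc (a 0)) (enc (a 0)))
                 (f-step : ∀ n → Step f (enc (a (suc n))) (enc (a n))) where

  enc∘a-mono-< : ∀ {m n} → m < n → enc (a m) < enc (a n)
  enc∘a-mono-< {m} {suc n} (s≤s m≤n) with m≤n⇒m<n∨m≡n m≤n
  ... | inj₁ m<n  = <-trans (enc∘a-mono-< m<n) (enc-mono-< (a-increasing n))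
  ... | inj₂ refl = enc-mono-< (a-increasing n)

  enc∘a-cancel-≤ : ∀ {m n} → enc (a m) ≤ enc (a n) → m ≤ n
  enc∘a-cancel-≤ am≤an = ≮⇒≥ (λ n<m → <⇒≱ (enc∘a-mono-< n<m) am≤an)

  retraces-+ : ∀ d m → Orbit f (a (d + m)) (a m)
  retraces-+ zero    m = ε
  retraces-+ (suc d) m = f-step (d + m) ◅ retraces-+ d m

  retraces : ∀ {m n} → m ≤ n → Orbit f (a n) (a m)
  retraces {m} {n} m≤n = subst (λ k → Orbit f (a k) (a m)) (m∸n+n≡m m≤n) (retraces-+ (n ∸ m) m)

  -- f(a 0) = a 0 is what keeps the orbit from leaving the sequence once it reaches a 0.
  orbit-stays-in-a : ∀ n {v} → Star (Step f) (enc (a n)) v → ∃ λ m → v ≡ enc (a m)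
  orbit-stays-in-a n ε = n , refl
  orbit-stays-in-a zero (s ◅ orbit) with Eval-deterministic s f-base
  ... | refl = orbit-stays-in-a zero orbit
  orbit-stays-in-a (suc n) (s ◅ orbit) with Eval-deterministic s (f-step n)
  ... | refl = orbit-stays-in-a n orbit

  module _ {A : Lang} (a-enumerates : ∀ w → A w ⇔ ∃ λ n → a n ≡ w) where

    member⇔orbit : ∀ {lo hi} → A hi → enc lo ≤ enc hi → A lo ⇔ Orbit f hi lo
    member⇔orbit {lo} {hi} A-hi lo≤hi with to (a-enumerates hi) A-hi
    ... | n , refl = mk⇔ on-orbit in-A
      where
      on-orbit : A lo → Orbit f (a n) lo
      on-orbit A-lo with to (a-enumerates lo) A-lo
      ... | m , refl = retraces (enc∘a-cancel-≤ lo≤hi)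

      in-A : Orbit f (a n) lo → A lo
      in-A orbit with orbit-stays-in-a n orbit
      ... | m , lo≡am = from (a-enumerates lo) (m , sym (enc-injective lo≡am))

    defeated-pair : ∀ {lo hi klo khi} {Plo Phi : Set} → enc lo ≤ enc hi →
                    Plo ⇔ Orbit f hi lo → ¬ Phi →
                    antitable klo Plo ⇔ table klo (A lo) → antitable khi Phi ⇔ table khi (A hi) → ⊥
    defeated-pair {klo = klo} {khi} lo≤hi Plo⇔orbit ¬Phi anti-lo anti-hi =
      antitable-forces khi ¬Phi anti-hi λ A-hi →
        antitable-defeats klo (⇔-trans Plo⇔orbit (⇔-sym (member⇔orbit A-hi lo≤hi))) anti-lo

witness : Code 1 → Code 1 → Code 1 → Bool → Word
witness q t f b = b ∷ serialise q (serialise t (serialise f []))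

witness-injective : ∀ {q t f b q′ t′ f′ b′} → witness q t f b ≡ witness q′ t′ f′ b′ →
                    q ≡ q′ × t ≡ t′ × f ≡ f′ × b ≡ b′
witness-injective {q} {t} {f} {q′ = q′} {t′} {f′} eq
  with serialise-injective q q′ (∷-injectiveʳ eq)
... | refl , eq₁ with serialise-injective t t′ eq₁
... | refl , eq₂ with serialise-injective f f′ eq₂
... | refl , _ with eq
... | refl = refl , refl , refl , refl

Runs : Code 1 → Code 1 → Code 1 → Bool → ℕ → ℕ → ℕ → Set
Runs q t f b m m′ k = Eval q (enc (witness q t f b) ∷ []) m
                    × Eval q (enc (witness q t f (not b)) ∷ []) m′
                    × Eval t (enc (witness q t f b) ∷ []) k

Runs-deterministic : ∀ {q t f b m m′ k n n′ j} → Runs q t f b m m′ k → Runs q t f b n n′ j →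
                     m ≡ n × m′ ≡ n′ × k ≡ j
Runs-deterministic (qm , qm′ , tk) (qn , qn′ , tj) =
  Eval-deterministic qm qn , Eval-deterministic qm′ qn′ , Eval-deterministic tk tj

-- Ties between the two queries are broken in favour of b = false being the lower one.
Below : Bool → ℕ → ℕ → Set
Below false = _≤_
Below true  = _<_

Target : Code 1 → Bool → ℕ → ℕ → Set
Target f b m m′ = Below b m m′ × Star (Step f) m′ m

L : Lang
L x = Σ (Code 1) λ q → Σ (Code 1) λ t → Σ (Code 1) λ f → Σ Bool λ b → witness q t f b ≡ x ×
      Σ ℕ λ m → Σ ℕ λ m′ → Σ ℕ λ k → Runs q t f b m m′ k × antitable k (Target f b m m′)

L-witness : ∀ {q t f b m m′ k} → Runs q t f b m m′ k →
            L (witness q t f b) ⇔ antitable k (Target f b m m′)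
L-witness {q} {t} {f} {b} runs =
  mk⇔ member (λ anti → q , t , f , b , refl , _ , _ , _ , runs , anti)
  where
  member : L (witness q t f b) → antitable _ (Target f b _ _)
  member (_ , _ , _ , _ , eq , _ , _ , _ , runs′ , anti) with witness-injective eq
  ... | refl , refl , refl , refl with Runs-deterministic runs′ runs
  ... | refl , refl , refl = anti

Target-below : ∀ {f b m m′} → Below b m m′ → Target f b m m′ ⇔ Star (Step f) m′ m
Target-below below = mk⇔ proj₂ (below ,_)

L-not-≤1tt-retraceable : ∀ A → L ≤1tt A → ¬ Retraceable A
L-not-≤1tt-retraceable A (q , t , reduce) (a , increasing , enumerates , f , base , step) =
  let y₀ , k₀ , q₀ , t₀ , reduce₀ = reduce (witness q t f false)
      y₁ , k₁ , q₁ , t₁ , reduce₁ = reduce (witness q t f true)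
      anti₀ = ⇔-trans (⇔-sym (L-witness (q₀ , q₁ , t₀))) reduce₀
      anti₁ = ⇔-trans (⇔-sym (L-witness (q₁ , q₀ , t₁))) reduce₁
  in Sum.[_,_]′
       (λ y₀≤y₁ → defeated-pair enumerates y₀≤y₁ (Target-below {b = false} y₀≤y₁)
                                 (≤⇒≯ y₀≤y₁ ∘ proj₁) anti₀ anti₁)
       (λ y₁<y₀ → defeated-pair enumerates (<⇒≤ y₁<y₀) (Target-below {b = true} y₁<y₀)
                                 (<⇒≱ y₁<y₀ ∘ proj₁) anti₁ anti₀)
       (≤-<-connex (enc y₀) (enc y₁))
  where open Retracing a increasing f base step using (defeated-pair)

theorem1 : Σ Lang λ L →
    ((L' : Lang) → In1ttDegree L L' → ¬ Retraceable L')
    × ((L' : Lang) → L ≤1tt L' → ¬ Retraceable L')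
theorem1 = L , (λ A (L≤A , _) → L-not-≤1tt-retraceable A L≤A) , L-not-≤1tt-retraceable
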